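{- Let $[a,b,c]$ be a primitive indefinite binary quadratic form of discriminant $d=b^2-4ac$, and let $$P=\frac1{\sqrt n}\begin{pmatrix}\frac12\big(v-\frac{bNu}{(a,N)}\big)&-\frac{cNu}{(a,N)}\\[2pt] \frac{aNu}{(a,N)}&\frac12\big(v+\frac{bNu}{(a,N)}\big)\end{pmatrix},\qquad v^2-\frac{dN^2}{(a,N)^2}u^2=4n,$$ be a hyperbolic element of $\Gamma^*$ with $\Gamma_P\ne\{1_2\}$. Let $(v_1,u_1)$ with $v_1,u_1>0$ be the fundamental solution of $v^2-d_1u^2=4$, where $d_1=dN^2/(a,N)^2$. Then $\Gamma_P$ is generated by the hyperbolic element $$P_1=\begin{pmatrix}\frac12\big(v_1-\frac{bNu_1}{(a,N)}\big)&-\frac{cNu_1}{(a,N)}\\[2pt] \frac{aNu_1}{(a,N)}&\frac12\big(v_1+\frac{bNu_1}{(a,N)}\big)\end{pmatrix}$$ of $\Gamma_0(N)$.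
   Context: $N>1$ is an integer that is not square free, $n$ a positive integer with $\gcd(n,N)=1$, and $(x,y)$ denotes the gcd. $\Gamma_0(N)=\{\begin{pmatrix}\alpha&\beta\\ \gamma&\delta\end{pmatrix}\in SL_2(\mathbb Z):N\mid\gamma\}$ acting on the upper half-plane by Möbius transformations. $\Gamma^*=\bigcup_{ad=n,\,a,d>0,\,0\le b<d}\frac1{\sqrt n}\begin{pmatrix}d&-b\\0&a\end{pmatrix}\Gamma_0(N)$; for $P\in\Gamma^*$, $\Gamma_P$ is the set of elements of $\Gamma_0(N)$ commuting with $P$. A form $[a,b,c]=ax^2+bxy+cy^2$ is primitive if $\gcd(a,b,c)=1$ and indefinite if $d>0$ is not a square. The fundamental solution of $v^2-Du^2=4$ is the solution in positive integers with least $u$. Here $u,v$ are integers. -}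

module Defs where

open import Data.Nat as ℕ using (ℕ; suc)
open import Data.Nat.Coprimality using (Coprime)
import Data.Nat.Divisibility as ℕD
open import Data.Nat.GCD as ℕG using ()
open import Data.Integer as ℤ using (ℤ; +_; -[1+_]; _+_; _-_; _*_; -_; ∣_∣; _<_; _≤_)
open import Data.Integer.Divisibility using (_∣_)
open import Data.Integer.GCD using (gcd)
open import Data.Product using (Σ; ∃; _×_; _,_)
open import Relation.Binary.PropositionalEquality using (_≡_)
open import Relation.Nullary using (¬_)

record Mat : Set where
  constructor mat
  field
    α β γ δ : ℤ
open Mat public

_·_ : Mat → Mat → Mat
mat a b c d · mat a' b' c' d' =
  mat (a * a' + b * c') (a * b' + b * d') (c * a' + d * c') (c * b' + d * d')

I₂ : Mat
I₂ = mat (+ 1) (+ 0) (+ 0) (+ 1)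

negM : Mat → Mat
negM (mat a b c d) = mat (- a) (- b) (- c) (- d)

det : Mat → ℤ
det (mat a b c d) = a * d - b * c

-- adjugate (= inverse for determinant-1 matrices)
adj : Mat → Mat
adj (mat a b c d) = mat d (- b) (- c) a

powℕ : Mat → ℕ → Mat
powℕ M ℕ.zero = I₂
powℕ M (suc k) = M · powℕ M k

powℤ : Mat → ℤ → Mat
powℤ M (+ k) = powℕ M k
powℤ M -[1+ k ] = powℕ (adj M) (suc k)

InΓ₀ : ℕ → Mat → Set
InΓ₀ N M = det M ≡ + 1 × (+ N ∣ γ M)

-- Γ* scaled by √n: an integer matrix M with (1/√n) M ∈ Γ*, i.e.
-- M = (d -b ; 0 a) γ with ad = n, a,d > 0, 0 ≤ b < d, γ ∈ Γ₀(N)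
InΓ*scaled : ℕ → ℕ → Mat → Set
InΓ*scaled N n M =
  Σ ℕ λ a → Σ ℕ λ d → Σ ℕ λ b → Σ Mat λ g →
    a ℕ.* d ≡ n × 0 ℕ.< a × 0 ℕ.< d × b ℕ.< d × InΓ₀ N g ×
    M ≡ mat (+ d) (- (+ b)) (+ 0) (+ a) · g

-- Γ_P : elements of Γ₀(N) commuting with P = (1/√n) M (equivalently with M)
InΓP : ℕ → Mat → Mat → Set
InΓP N M g = InΓ₀ N g × g · M ≡ M · g

SquareFree : ℕ → Set
SquareFree N = ∀ m → 1 ℕ.< m → ¬ (m ℕ.* m ℕD.∣ N)

Primitive : ℤ → ℤ → ℤ → Set
Primitive a b c = gcd (gcd a b) c ≡ + 1

disc : ℤ → ℤ → ℤ → ℤ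
disc a b c = b * b - (+ 4) * a * c

Indefinite : ℤ → ℤ → ℤ → Set
Indefinite a b c = + 0 < disc a b c × ¬ (∃ λ m → m * m ≡ disc a b c)

-- M is the integer matrix √n·P built from (a,b,c,u,v) with k = N/(a,N):
-- ( (v - bku)/2   -cku ; aku   (v + bku)/2 )
IsFormMat : ℤ → ℤ → ℤ → ℕ → ℤ → ℤ → Mat → Set
IsFormMat a b c k u v M =
  (+ 2) * α M ≡ v - b * + k * u ×
  β M ≡ - (c * + k * u) ×
  γ M ≡ a * + k * u ×
  (+ 2) * δ M ≡ v + b * + k * u

IsFundamental : ℤ → ℤ → ℤ → Set
IsFundamental D v₁ u₁ =
  + 0 < v₁ × + 0 < u₁ × v₁ * v₁ - D * (u₁ * u₁) ≡ + 4 ×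
  (∀ v u → + 0 < v → + 0 < u → v * v - D * (u * u) ≡ + 4 → u₁ ≤ u)

-- The form matrix M = √n·P equals x·1 + u·k·(0 −c; a b) with k = N/(a,N) and u ≠ 0.
-- Since [a,b,c] is primitive, a matrix commuting with it has the shape x′·1 + y·(0 −c; a b),
-- and the level condition N ∣ γ forces k ∣ y.  Hence Γ_P consists of the matrices
-- x·1 + w·k·(0 −c; a b) of determinant 1, which correspond to the solutions (2x + bkw, w)
-- of v² − d₁w² = 4.  Multiplying such a matrix of positive trace and w > 0 by P₁⁻¹ gives
-- one of positive trace with 0 ≤ w′ < w (the classical descent, which uses the minimality
-- of u₁), so it is a power of P₁; the cases w < 0 and negative trace reduce to this one
-- through the adjugate and through −1.

{-# OPTIONS --safe #-}
module Submission where

open import Defs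
open import Data.Nat as ℕ using (ℕ)
open import Data.Nat.Coprimality using (Coprime)
open import Data.Nat.GCD using (gcd)
open import Data.Integer using (ℤ; +_; _+_; _-_; _*_; -_; ∣_∣; _<_)
open import Data.Product using (Σ; ∃; _×_; _,_)
open import Data.Sum using (_⊎_)
open import Relation.Binary.PropositionalEquality using (_≡_; _≢_)
open import Relation.Nullary using (¬_)

open import Data.Integer using (_≤_; -[1+_]; +[1+_]; +≤+; +<+; nonNegative; ≢-nonZero)
open import Data.Integer.Tactic.RingSolver using (solve-∀)
import Data.Integer.Properties as ℤ
import Data.Integer.Divisibility as Unsigned
open import Data.Integer.Divisibility.Signed using (_∣_; divides; quotient; ∣ᵤ⇒∣; ∣⇒∣ᵤ)
import Data.Nat.Properties as ℕ
import Data.Nat.Divisibility as ℕ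
import Data.Nat.GCD as ℕ
open import Data.Nat.Coprimality using (coprime-divisor; gcd≡1⇒coprime)
open import Data.Nat.Primality using (euclidsLemma; prime[2])
open import Data.Nat.Induction using (<-wellFounded)
open import Induction.WellFounded using (Acc; acc)
open import Data.Product using (∃-syntax; proj₁; proj₂; uncurry)
open import Data.Sum using (inj₁; inj₂; [_,_])
open import Data.Empty using (⊥-elim)
open import Function using (id)
open import Relation.Binary.PropositionalEquality
  using (refl; sym; trans; cong; cong₂; subst; subst₂; module ≡-Reasoning)
open import Relation.Binary.Definitions using (tri<; tri≈; tri>)
open import Relation.Nullary using (yes; no)

mat-cong : ∀ {a b c d a′ b′ c′ d′} → a ≡ a′ → b ≡ b′ → c ≡ c′ → d ≡ d′ →
           mat a b c d ≡ mat a′ b′ c′ d′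
mat-cong refl refl refl refl = refl

·-assoc : ∀ A B C → (A · B) · C ≡ A · (B · C)
·-assoc (mat a b c d) (mat e f g h) (mat i j k l) =
  mat-cong (entry a b e f g h i k) (entry a b e f g h j l)
           (entry c d e f g h i k) (entry c d e f g h j l)
  where
  entry : ∀ x₁ x₂ y₁ y₂ y₃ y₄ z₁ z₂ →
    (x₁ * y₁ + x₂ * y₃) * z₁ + (x₁ * y₂ + x₂ * y₄) * z₂ ≡
    x₁ * (y₁ * z₁ + y₂ * z₂) + x₂ * (y₃ * z₁ + y₄ * z₂)
  entry = solve-∀

·-identityˡ : ∀ A → I₂ · A ≡ A
·-identityˡ (mat a b c d) = mat-cong (first a c) (first b d) (second a c) (second b d)
  where
  first : ∀ x y → + 1 * x + + 0 * y ≡ x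
  first = solve-∀
  second : ∀ x y → + 0 * x + + 1 * y ≡ y
  second = solve-∀

·-identityʳ : ∀ A → A · I₂ ≡ A
·-identityʳ (mat a b c d) = mat-cong (first a b) (second a b) (first c d) (second c d)
  where
  first : ∀ x y → x * + 1 + y * + 0 ≡ x
  first = solve-∀
  second : ∀ x y → x * + 0 + y * + 1 ≡ y
  second = solve-∀

adj-anti-· : ∀ A B → adj (A · B) ≡ adj B · adj A
adj-anti-· (mat a b c d) (mat e f g h) =
  mat-cong (entry-α c d f h) (entry-β a b f h) (entry-γ c d e g) (entry-δ a b e g)
  where
  entry-α : ∀ c d f h → c * f + d * h ≡ h * d + (- f) * (- c)
  entry-α = solve-∀
  entry-β : ∀ a b f h → - (a * f + b * h) ≡ h * (- b) + (- f) * a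
  entry-β = solve-∀
  entry-γ : ∀ c d e g → - (c * e + d * g) ≡ (- g) * d + e * (- c)
  entry-γ = solve-∀
  entry-δ : ∀ a b e g → a * e + b * g ≡ (- g) * (- b) + e * a
  entry-δ = solve-∀

adj-involutive : ∀ A → adj (adj A) ≡ A
adj-involutive (mat a b c d) = mat-cong refl (ℤ.neg-involutive b) (ℤ.neg-involutive c) refl

negM-involutive : ∀ A → negM (negM A) ≡ A
negM-involutive (mat a b c d) =
  mat-cong (ℤ.neg-involutive a) (ℤ.neg-involutive b) (ℤ.neg-involutive c) (ℤ.neg-involutive d)

det-· : ∀ A B → det (A · B) ≡ det A * det B
det-· (mat a b c d) (mat e f g h) = multiplicative a b c d e f g h
  where
  multiplicative : ∀ a b c d e f g h →
    (a * e + b * g) * (c * f + d * h) - (a * f + b * h) * (c * e + d * g) ≡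
    (a * d - b * c) * (e * h - f * g)
  multiplicative = solve-∀

det-adj : ∀ A → det (adj A) ≡ det A
det-adj (mat a b c d) = invariant a b c d
  where
  invariant : ∀ a b c d → d * a - (- b) * (- c) ≡ a * d - b * c
  invariant = solve-∀

det-negM : ∀ A → det (negM A) ≡ det A
det-negM (mat a b c d) = invariant a b c d
  where
  invariant : ∀ a b c d → (- a) * (- d) - (- b) * (- c) ≡ a * d - b * c
  invariant = solve-∀

adj-inverseʳ : ∀ A → det A ≡ + 1 → A · adj A ≡ I₂
adj-inverseʳ (mat a b c d) det≡1 =
  mat-cong (trans (diagonal a b c d) det≡1) (off-diagonal a b)
           (off-diagonal′ c d) (trans (diagonal′ a b c d) det≡1)
  where
  diagonal : ∀ a b c d → a * d + b * (- c) ≡ a * d - b * c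
  diagonal = solve-∀
  diagonal′ : ∀ a b c d → c * (- b) + d * a ≡ a * d - b * c
  diagonal′ = solve-∀
  off-diagonal : ∀ a b → a * (- b) + b * a ≡ + 0
  off-diagonal = solve-∀
  off-diagonal′ : ∀ c d → c * d + d * (- c) ≡ + 0
  off-diagonal′ = solve-∀

commute⇒B·[A·adjB]≡A : ∀ A B → B · A ≡ A · B → det B ≡ + 1 → B · (A · adj B) ≡ A
commute⇒B·[A·adjB]≡A A B BA≡AB det≡1 = begin
  B · (A · adj B)  ≡⟨ sym (·-assoc B A (adj B)) ⟩
  (B · A) · adj B  ≡⟨ cong (_· adj B) BA≡AB ⟩
  (A · B) · adj B  ≡⟨ ·-assoc A B (adj B) ⟩
  A · (B · adj B)  ≡⟨ cong (A ·_) (adj-inverseʳ B det≡1) ⟩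
  A · I₂           ≡⟨ ·-identityʳ A ⟩
  A                ∎
  where open ≡-Reasoning

powℕ-comm : ∀ A m → powℕ A m · A ≡ A · powℕ A m
powℕ-comm A ℕ.zero    = trans (·-identityˡ A) (sym (·-identityʳ A))
powℕ-comm A (ℕ.suc m) = trans (·-assoc A (powℕ A m) A) (cong (A ·_) (powℕ-comm A m))

adj-powℕ : ∀ A m → adj (powℕ A m) ≡ powℕ (adj A) m
adj-powℕ A ℕ.zero    = refl
adj-powℕ A (ℕ.suc m) = begin
  adj (A · powℕ A m)          ≡⟨ adj-anti-· A (powℕ A m) ⟩
  adj (powℕ A m) · adj A      ≡⟨ cong (_· adj A) (adj-powℕ A m) ⟩
  powℕ (adj A) m · adj A      ≡⟨ powℕ-comm (adj A) m ⟩
  adj A · powℕ (adj A) m      ∎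
  where open ≡-Reasoning

adj-powℕ≡powℤ-neg : ∀ A m → adj (powℕ A m) ≡ powℤ A (- + m)
adj-powℕ≡powℤ-neg A ℕ.zero      = refl
adj-powℕ≡powℤ-neg A m@(ℕ.suc _) = adj-powℕ A m

0≤i*j : ∀ {i j} → + 0 ≤ i → + 0 ≤ j → + 0 ≤ i * j
0≤i*j {+ m} {+ n} _ _ = subst (+ 0 ≤_) (ℤ.pos-* m n) (+≤+ ℕ.z≤n)

0≤i*i : ∀ i → + 0 ≤ i * i
0≤i*i (+ n)    = 0≤i*j {+ n} {+ n} (+≤+ ℕ.z≤n) (+≤+ ℕ.z≤n)
0≤i*i -[1+ n ] = +≤+ ℕ.z≤n

0<i*j : ∀ {i j} → + 0 < i → + 0 < j → + 0 < i * j
0<i*j {+[1+ m ]} {+[1+ n ]} _ _ = +<+ (ℕ.s≤s ℕ.z≤n)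
0<i*j {+ ℕ.zero} (+<+ ()) _
0<i*j {_} {+ ℕ.zero} _ (+<+ ())

0<2*i⇒0<i : ∀ {i} → + 0 < + 2 * i → + 0 < i
0<2*i⇒0<i = ℤ.*-cancelˡ-<-nonNeg (+ 2)

0≤2*i⇒0≤i : ∀ {i} → + 0 ≤ + 2 * i → + 0 ≤ i
0≤2*i⇒0≤i {i} = ℤ.*-cancelˡ-≤-pos (+ 0) i (+ 2)

i<j⇒0<j-i : ∀ {i j} → i < j → + 0 < j - i
i<j⇒0<j-i {i} {j} i<j = subst (_< j - i) (ℤ.+-inverseʳ i) (ℤ.+-monoˡ-< (- i) i<j)

≤-offset : ∀ {i j z} → + 0 ≤ z → j ≡ i + z → i ≤ j
≤-offset {i} {z = z} 0≤z refl = ℤ.i≤i+j i z {{nonNegative 0≤z}}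

<-offset : ∀ {i j z} → + 0 < z → j ≡ i + z → i < j
<-offset {i} {z = z} 0<z refl = subst (_< i + z) (ℤ.+-identityʳ i) (ℤ.+-monoʳ-< i 0<z)

∣∣-mono-< : ∀ {i j} → + 0 ≤ i → i < j → ∣ i ∣ ℕ.< ∣ j ∣
∣∣-mono-< {+ m} {+ n} _ (+<+ m<n) = m<n

square-mono-≤ : ∀ {i j} → + 0 ≤ i → i ≤ j → i * i ≤ j * j
square-mono-≤ {+ m} {+ n} _ (+≤+ m≤n) =
  subst₂ _≤_ (ℤ.pos-* m m) (ℤ.pos-* n n) (+≤+ (ℕ.*-mono-≤ m≤n m≤n))

square-mono-< : ∀ {i j} → + 0 ≤ i → i < j → i * i < j * j
square-mono-< {+ m} {+ n} _ (+<+ m<n) =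
  subst₂ _<_ (ℤ.pos-* m m) (ℤ.pos-* n n) (+<+ (ℕ.*-mono-< m<n m<n))

square-≤⇒≤ : ∀ {i j} → + 0 ≤ j → i * i ≤ j * j → i ≤ j
square-≤⇒≤ {i} {j} 0≤j i²≤j² with i ℤ.≤? j
... | yes i≤j = i≤j
... | no  i≰j = ⊥-elim (ℤ.<⇒≱ (square-mono-< 0≤j (ℤ.≰⇒> i≰j)) i²≤j²)

square-<⇒< : ∀ {i j} → + 0 ≤ j → i * i < j * j → i < j
square-<⇒< {i} {j} 0≤j i²<j² with j ℤ.≤? i
... | yes j≤i = ⊥-elim (ℤ.<⇒≱ i²<j² (square-mono-≤ 0≤j j≤i))
... | no  j≰i = ℤ.≰⇒> j≰i

square≡1⇒≡1 : ∀ {i} → + 0 < i → i * i ≡ + 1 → i ≡ + 1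
square≡1⇒≡1 {+[1+ ℕ.zero ]}  _ _ = refl
square≡1⇒≡1 {+[1+ ℕ.suc _ ]} _ ()
square≡1⇒≡1 {+ ℕ.zero} (+<+ ()) _

-- The Pell equation v² − d u² = 4

record PellSolution (d v u : ℤ) : Set where
  constructor pell
  field equation : v * v - d * (u * u) ≡ + 4

pell-4≤v² : ∀ {d v u} → + 0 ≤ d → PellSolution d v u → + 4 ≤ v * v
pell-4≤v² {d} {v} {u} 0≤d (pell eq) =
  ≤-offset (0≤i*j 0≤d (0≤i*i u)) (trans (split v d u) (cong (_+ d * (u * u)) eq))
  where
  split : ∀ v d u → v * v ≡ (v * v - d * (u * u)) + d * (u * u)
  split = solve-∀

pell-v≢0 : ∀ {d v u} → + 0 ≤ d → PellSolution d v u → v ≢ + 0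
pell-v≢0 0≤d p refl with pell-4≤v² 0≤d p
... | +≤+ ()

pell-2≤v : ∀ {d v u} → + 0 ≤ d → + 0 ≤ v → PellSolution d v u → + 2 ≤ v
pell-2≤v 0≤d 0≤v p = square-≤⇒≤ 0≤v (pell-4≤v² 0≤d p)

pell-product-dominant : ∀ {d T w t u} → + 0 ≤ d → + 0 ≤ T → + 0 ≤ t →
  PellSolution d T w → PellSolution d t u → d * w * u < T * t
pell-product-dominant {d} {T} {w} {t} {u} 0≤d 0≤T 0≤t (pell pellT) (pell pellt) =
  square-<⇒< (0≤i*j 0≤T 0≤t) (<-offset 0<excess (begin
    (T * t) * (T * t)  ≡⟨ expand d T w t u ⟩
    (d * w * u) * (d * w * u) + excess (T * T - d * (w * w)) (t * t - d * (u * u))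
      ≡⟨ cong₂ (λ P p → (d * w * u) * (d * w * u) + excess P p) pellT pellt ⟩
    (d * w * u) * (d * w * u) + excess (+ 4) (+ 4)  ∎))
  where
  open ≡-Reasoning
  excess : ℤ → ℤ → ℤ
  excess P p = P * p + P * d * (u * u) + p * d * (w * w)
  expand : ∀ d T w t u → (T * t) * (T * t) ≡ (d * w * u) * (d * w * u) +
    ((T * T - d * (w * w)) * (t * t - d * (u * u)) + (T * T - d * (w * w)) * d * (u * u)
      + (t * t - d * (u * u)) * d * (w * w))
  expand = solve-∀
  0≤4d : + 0 ≤ + 4 * d
  0≤4d = 0≤i*j {+ 4} (+≤+ ℕ.z≤n) 0≤d
  0<excess : + 0 < excess (+ 4) (+ 4)
  0<excess = ℤ.+-mono-<-≤ (ℤ.+-mono-<-≤ (+<+ (ℕ.s≤s ℕ.z≤n)) (0≤i*j {+ 4 * d} {u * u} 0≤4d (0≤i*i u)))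
                          (0≤i*j {+ 4 * d} {w * w} 0≤4d (0≤i*i w))

pell-cross-dominant : ∀ {d T w t u} → + 0 ≤ u → u ≤ w → + 0 ≤ w * t →
  PellSolution d T w → PellSolution d t u → T * u ≤ w * t
pell-cross-dominant {d} {T} {w} {t} {u} 0≤u u≤w 0≤wt (pell pellT) (pell pellt) =
  square-≤⇒≤ 0≤wt (≤-offset 0≤excess (begin
    (w * t) * (w * t)  ≡⟨ expand d T w t u ⟩
    (T * u) * (T * u) + excess (T * T - d * (w * w)) (t * t - d * (u * u))
      ≡⟨ cong₂ (λ P p → (T * u) * (T * u) + excess P p) pellT pellt ⟩
    (T * u) * (T * u) + excess (+ 4) (+ 4)  ∎))
  where
  open ≡-Reasoning
  excess : ℤ → ℤ → ℤ
  excess P p = p * (w * w) - P * (u * u)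
  expand : ∀ d T w t u → (w * t) * (w * t) ≡
    (T * u) * (T * u) + ((t * t - d * (u * u)) * (w * w) - (T * T - d * (w * w)) * (u * u))
  expand = solve-∀
  0≤excess : + 0 ≤ excess (+ 4) (+ 4)
  0≤excess = ℤ.i≤j⇒0≤j-i (ℤ.*-monoˡ-≤-nonNeg (+ 4) (square-mono-≤ 0≤u u≤w))

pell-quotient-identity : ∀ {d t u} T w T′ w′ → PellSolution d t u →
  + 2 * T′ ≡ T * t - d * w * u → + 2 * w′ ≡ w * t - T * u → w′ * t + T′ * u ≡ + 2 * w
pell-quotient-identity {d} {t} {u} T w T′ w′ (pell pellt) 2T′≡ 2w′≡ =
  ℤ.*-cancelˡ-≡ (+ 2) _ _ (begin
    + 2 * (w′ * t + T′ * u)                      ≡⟨ distrib w′ T′ t u ⟩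
    (+ 2 * w′) * t + (+ 2 * T′) * u              ≡⟨ cong₂ (λ x y → x * t + y * u) 2w′≡ 2T′≡ ⟩
    (w * t - T * u) * t + (T * t - d * w * u) * u ≡⟨ collect d T w t u ⟩
    w * (t * t - d * (u * u))                    ≡⟨ cong (w *_) pellt ⟩
    w * + 4                                      ≡⟨ double w ⟩
    + 2 * (+ 2 * w)                              ∎)
  where
  open ≡-Reasoning
  distrib : ∀ w′ T′ t u → + 2 * (w′ * t + T′ * u) ≡ (+ 2 * w′) * t + (+ 2 * T′) * u
  distrib = solve-∀
  collect : ∀ d T w t u → (w * t - T * u) * t + (T * t - d * w * u) * u ≡ w * (t * t - d * (u * u))
  collect = solve-∀
  double : ∀ w → w * + 4 ≡ + 2 * (+ 2 * w)
  double = solve-∀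

-- (T′ + w′√d)/2 is the quotient (T + w√d)/(t + u√d) of the units attached to the two solutions.
pell-descent : ∀ {d T w t u} T′ w′ → + 0 ≤ d → + 0 < T → + 0 < t → + 0 < u → u ≤ w →
  PellSolution d T w → PellSolution d t u →
  + 2 * T′ ≡ T * t - d * w * u → + 2 * w′ ≡ w * t - T * u →
  + 0 < T′ × + 0 ≤ w′ × w′ < w
pell-descent {d} {T} {w} {t} {u} T′ w′ 0≤d 0<T 0<t 0<u u≤w pellT pellt 2T′≡ 2w′≡ =
  0<T′ , 0≤w′ , ℤ.*-cancelˡ-<-nonNeg (+ 2) 2w′<2w
  where
  0≤t = ℤ.<⇒≤ 0<t
  0≤w = ℤ.≤-trans (ℤ.<⇒≤ 0<u) u≤w
  0<T′ : + 0 < T′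
  0<T′ = 0<2*i⇒0<i (subst (+ 0 <_) (sym 2T′≡)
    (i<j⇒0<j-i (pell-product-dominant 0≤d (ℤ.<⇒≤ 0<T) 0≤t pellT pellt)))
  0≤w′ : + 0 ≤ w′
  0≤w′ = 0≤2*i⇒0≤i (subst (+ 0 ≤_) (sym 2w′≡)
    (ℤ.i≤j⇒0≤j-i (pell-cross-dominant (ℤ.<⇒≤ 0<u) u≤w (0≤i*j 0≤w 0≤t) pellT pellt)))
  2w′<2w : + 2 * w′ < + 2 * w
  2w′<2w = begin-strict
    + 2 * w′         ≡⟨ ℤ.*-comm (+ 2) w′ ⟩
    w′ * + 2         ≤⟨ ℤ.*-monoˡ-≤-nonNeg w′ {{nonNegative 0≤w′}} (pell-2≤v 0≤d 0≤t pellt) ⟩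
    w′ * t           <⟨ <-offset (0<i*j 0<T′ 0<u) refl ⟩
    w′ * t + T′ * u  ≡⟨ pell-quotient-identity T w T′ w′ pellt 2T′≡ 2w′≡ ⟩
    + 2 * w          ∎
    where open ℤ.≤-Reasoning

gcd[gcd[x,y],z]≡1⇒∣ : ∀ {m r x y z} → gcd (gcd x y) z ≡ 1 →
  m ℕ.∣ r ℕ.* x → m ℕ.∣ r ℕ.* y → m ℕ.∣ r ℕ.* z → m ℕ.∣ r
gcd[gcd[x,y],z]≡1⇒∣ {m} {r} {x} {y} {z} gcd≡1 m∣rx m∣ry m∣rz =
  subst (m ℕ.∣_) r-as-gcd (ℕ.gcd-greatest (ℕ.gcd-greatest m∣rx m∣ry) m∣rz)
  where
  open ≡-Reasoning
  r-as-gcd : gcd (gcd (r ℕ.* x) (r ℕ.* y)) (r ℕ.* z) ≡ r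
  r-as-gcd = begin
    gcd (gcd (r ℕ.* x) (r ℕ.* y)) (r ℕ.* z)  ≡⟨ cong (λ g → gcd g (r ℕ.* z)) (ℕ.c*gcd[m,n]≡gcd[cm,cn] r x y) ⟨
    gcd (r ℕ.* gcd x y) (r ℕ.* z)            ≡⟨ ℕ.c*gcd[m,n]≡gcd[cm,cn] r (gcd x y) z ⟨
    r ℕ.* gcd (gcd x y) z                    ≡⟨ cong (r ℕ.*_) gcd≡1 ⟩
    r ℕ.* 1                                  ≡⟨ ℕ.*-identityʳ r ⟩
    r                                        ∎

primitive-divisor : ∀ {m r x y z} → Primitive x y z →
  m ∣ r * x → m ∣ r * y → m ∣ r * z → m ∣ r
primitive-divisor {r = r} {x} {y} {z} prim m∣rx m∣ry m∣rz =
  ∣ᵤ⇒∣ (gcd[gcd[x,y],z]≡1⇒∣ (ℤ.+-injective prim) (toℕ x m∣rx) (toℕ y m∣ry) (toℕ z m∣rz))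
  where
  toℕ : ∀ {m} s → m ∣ r * s → ∣ m ∣ ℕ.∣ ∣ r ∣ ℕ.* ∣ s ∣
  toℕ s m∣rs = subst (_ ℕ.∣_) (ℤ.abs-* r s) (∣⇒∣ᵤ m∣rs)

k*gcd[m,N]≡N⇒N∣m*k : ∀ {k m N} → k ℕ.* gcd m N ≡ N → N ℕ.∣ m ℕ.* k
k*gcd[m,N]≡N⇒N∣m*k {k} {m} {N} k*g≡N = ℕ.divides q (begin
  m ℕ.* k            ≡⟨ cong (ℕ._* k) m≡q*g ⟩
  q ℕ.* g ℕ.* k      ≡⟨ ℕ.*-assoc q g k ⟩
  q ℕ.* (g ℕ.* k)    ≡⟨ cong (q ℕ.*_) (trans (ℕ.*-comm g k) k*g≡N) ⟩
  q ℕ.* N            ∎)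
  where
  open ≡-Reasoning
  g = gcd m N
  q = ℕ._∣_.quotient (ℕ.gcd[m,n]∣m m N)
  m≡q*g = ℕ._∣_.equality (ℕ.gcd[m,n]∣m m N)

-- k = N/(m,N) is coprime to m/(m,N).
k*gcd[m,N]≡N⇒∣ : ∀ {k m N y} → k ℕ.* gcd m N ≡ N → N ≢ 0 → N ℕ.∣ y ℕ.* m → k ℕ.∣ y
k*gcd[m,N]≡N⇒∣ {k} {m} {N} {y} k*g≡N N≢0 N∣y*m =
  coprime-divisor (gcd≡1⇒coprime gcd[k,q]≡1) (subst (k ℕ.∣_) (ℕ.*-comm y q) k∣y*q)
  where
  open ≡-Reasoning
  g = gcd m N
  g≢0 : g ≢ 0
  g≢0 g≡0 = N≢0 (trans (sym k*g≡N) (trans (cong (k ℕ.*_) g≡0) (ℕ.*-zeroʳ k)))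
  instance
    _ = ℕ.≢-nonZero g≢0
  q = ℕ._∣_.quotient (ℕ.gcd[m,n]∣m m N)
  m≡q*g = ℕ._∣_.equality (ℕ.gcd[m,n]∣m m N)
  k∣y*q : k ℕ.∣ y ℕ.* q
  k∣y*q = ℕ.*-cancelʳ-∣ g (subst₂ ℕ._∣_ (sym k*g≡N)
    (trans (cong (y ℕ.*_) m≡q*g) (sym (ℕ.*-assoc y q g))) N∣y*m)
  gcd[k,q]≡1 : gcd k q ≡ 1
  gcd[k,q]≡1 = ℕ.*-cancelˡ-≡ _ _ g (begin
    g ℕ.* gcd k q              ≡⟨ ℕ.c*gcd[m,n]≡gcd[cm,cn] g k q ⟩
    gcd (g ℕ.* k) (g ℕ.* q)    ≡⟨ cong₂ gcd (trans (ℕ.*-comm g k) k*g≡N) (trans (ℕ.*-comm g q) (sym m≡q*g)) ⟩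
    gcd N m                    ≡⟨ ℕ.gcd-comm N m ⟩
    g                          ≡⟨ ℕ.*-identityʳ g ⟨
    g ℕ.* 1                    ∎)

k*gcd[m,N]≡N⇒k*u≢0 : ∀ {k m N u} → k ℕ.* gcd m N ≡ N → N ≢ 0 → u ≢ + 0 → + k * u ≢ + 0
k*gcd[m,N]≡N⇒k*u≢0 {k} {m} {N} {u} k*g≡N N≢0 u≢0 ku≡0 =
  [ k≢0 , u≢0 ] (ℤ.i*j≡0⇒i≡0∨j≡0 (+ k) ku≡0)
  where
  k≢0 : + k ≢ + 0
  k≢0 k≡0 = N≢0 (trans (sym k*g≡N) (cong (ℕ._* gcd m N) (ℤ.+-injective k≡0)))

2∣i*i⇒2∣i : ∀ {i} → + 2 ∣ i * i → + 2 ∣ i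
2∣i*i⇒2∣i {i} 2∣i*i = ∣ᵤ⇒∣ ([ id , id ] (euclidsLemma ∣ i ∣ ∣ i ∣ prime[2]
  (subst (2 ℕ.∣_) (ℤ.abs-* i i) (∣⇒∣ᵤ 2∣i*i))))

primitive-proportional : ∀ a b c q r t → a ≢ + 0 → Primitive a b c →
  a * q + c * r ≡ + 0 → a * t ≡ b * r → ∃[ y ] r ≡ y * a × t ≡ b * y × q ≡ - (c * y)
primitive-proportional a b c q r t a≢0 prim aq+cr≡0 at≡br =
  y , r≡y*a , t≡b*y , q≡-c*y
  where
  instance
    _ = ≢-nonZero a≢0
  a∣r : a ∣ r
  a∣r = primitive-divisor prim
    (divides r refl)
    (divides t (trans (ℤ.*-comm r b) (trans (sym at≡br) (ℤ.*-comm a t))))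
    (divides (- q) (trans (cr-as-aq a c q r) (trans (cong (_+ (- q) * a) aq+cr≡0) (ℤ.+-identityˡ _))))
    where
    cr-as-aq : ∀ a c q r → r * c ≡ (a * q + c * r) + (- q) * a
    cr-as-aq = solve-∀
  y = _∣_.quotient a∣r
  r≡y*a = _∣_.equality a∣r
  t≡b*y : t ≡ b * y
  t≡b*y = ℤ.*-cancelˡ-≡ a t (b * y) (begin
    a * t        ≡⟨ at≡br ⟩
    b * r        ≡⟨ cong (b *_) r≡y*a ⟩
    b * (y * a)  ≡⟨ swap a b y ⟩
    a * (b * y)  ∎)
    where
    open ≡-Reasoning
    swap : ∀ a b y → b * (y * a) ≡ a * (b * y)
    swap = solve-∀
  q≡-c*y : q ≡ - (c * y)
  q≡-c*y = ℤ.*-cancelˡ-≡ a q (- (c * y)) (begin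
    a * q                                   ≡⟨ isolate a c q y ⟩
    (a * q + c * (y * a)) + a * (- (c * y))  ≡⟨ cong (λ s → (a * q + c * s) + a * (- (c * y))) r≡y*a ⟨
    (a * q + c * r) + a * (- (c * y))        ≡⟨ cong (_+ a * (- (c * y))) aq+cr≡0 ⟩
    + 0 + a * (- (c * y))                    ≡⟨ ℤ.+-identityˡ _ ⟩
    a * (- (c * y))                          ∎)
    where
    open ≡-Reasoning
    isolate : ∀ a c q y → a * q ≡ (a * q + c * (y * a)) + a * (- (c * y))
    isolate = solve-∀

-- Form matrices

±PowerOf : Mat → Mat → Set
±PowerOf P g = ∃[ j ] (g ≡ powℤ P j ⊎ g ≡ negM (powℤ P j))

module FormMatrix (a b c : ℤ) (k : ℕ) where

  -- formMat x w satisfies IsFormMat with u = w and v = trace x w; in the theorem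
  -- K = N/(a,N), so d₁ is the paper's dN²/(a,N)².
  K : ℤ
  K = + k

  formMat : ℤ → ℤ → Mat
  formMat x w = mat x (- (c * K * w)) (a * K * w) (x + b * K * w)

  trace : ℤ → ℤ → ℤ
  trace x w = + 2 * x + b * K * w

  d₁ : ℤ
  d₁ = disc a b c * (K * K)

  formMat-comm : ∀ x w y z → formMat x w · formMat y z ≡ formMat y z · formMat x w
  formMat-comm x w y z =
    mat-cong (entry-α a b c K x w y z) (entry-β a b c K x w y z)
             (entry-γ a b c K x w y z) (entry-δ a b c K x w y z)
    where
    entry-α : ∀ a b c K x w y z →
      x * y + (- (c * K * w)) * (a * K * z) ≡ y * x + (- (c * K * z)) * (a * K * w)
    entry-α = solve-∀
    entry-β : ∀ a b c K x w y z →
      x * (- (c * K * z)) + (- (c * K * w)) * (y + b * K * z) ≡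
      y * (- (c * K * w)) + (- (c * K * z)) * (x + b * K * w)
    entry-β = solve-∀
    entry-γ : ∀ a b c K x w y z →
      (a * K * w) * y + (x + b * K * w) * (a * K * z) ≡
      (a * K * z) * x + (y + b * K * z) * (a * K * w)
    entry-γ = solve-∀
    entry-δ : ∀ a b c K x w y z →
      (a * K * w) * (- (c * K * z)) + (x + b * K * w) * (y + b * K * z) ≡
      (a * K * z) * (- (c * K * w)) + (y + b * K * z) * (x + b * K * w)
    entry-δ = solve-∀

  4*det-formMat : ∀ x w → + 4 * det (formMat x w) ≡ trace x w * trace x w - d₁ * (w * w)
  4*det-formMat x w = identity a b c K x w
    where
    identity : ∀ a b c K x w →
      + 4 * (x * (x + b * K * w) - (- (c * K * w)) * (a * K * w)) ≡
      (+ 2 * x + b * K * w) * (+ 2 * x + b * K * w) - (b * b - + 4 * a * c) * (K * K) * (w * w)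
    identity = solve-∀

  det≡1⇒pell : ∀ x w → det (formMat x w) ≡ + 1 → PellSolution d₁ (trace x w) w
  det≡1⇒pell x w det≡1 = pell (trans (sym (4*det-formMat x w)) (cong (+ 4 *_) det≡1))

  pell⇒det≡1 : ∀ x w → PellSolution d₁ (trace x w) w → det (formMat x w) ≡ + 1
  pell⇒det≡1 x w (pell eq) = ℤ.*-cancelˡ-≡ (+ 4) _ _ (trans (4*det-formMat x w) eq)

  adj-formMat : ∀ x w → adj (formMat x w) ≡ formMat (x + b * K * w) (- w)
  adj-formMat x w = mat-cong refl (entry-β c K w) (entry-γ a K w) (entry-δ b K x w)
    where
    entry-β : ∀ c K w → - (- (c * K * w)) ≡ - (c * K * (- w))
    entry-β = solve-∀
    entry-γ : ∀ a K w → - (a * K * w) ≡ a * K * (- w)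
    entry-γ = solve-∀
    entry-δ : ∀ b K x w → x ≡ x + b * K * w + b * K * (- w)
    entry-δ = solve-∀

  trace-adj : ∀ x w → trace (x + b * K * w) (- w) ≡ trace x w
  trace-adj x w = identity b K x w
    where
    identity : ∀ b K x w → + 2 * (x + b * K * w) + b * K * (- w) ≡ + 2 * x + b * K * w
    identity = solve-∀

  negM-formMat : ∀ x w → negM (formMat x w) ≡ formMat (- x) (- w)
  negM-formMat x w = mat-cong refl (entry-β c K w) (entry-γ a K w) (entry-δ b K x w)
    where
    entry-β : ∀ c K w → - (- (c * K * w)) ≡ - (c * K * (- w))
    entry-β = solve-∀
    entry-γ : ∀ a K w → - (a * K * w) ≡ a * K * (- w)
    entry-γ = solve-∀
    entry-δ : ∀ b K x w → - (x + b * K * w) ≡ - x + b * K * (- w)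
    entry-δ = solve-∀

  trace-neg : ∀ x w → trace (- x) (- w) ≡ - trace x w
  trace-neg x w = identity b K x w
    where
    identity : ∀ b K x w → + 2 * (- x) + b * K * (- w) ≡ - (+ 2 * x + b * K * w)
    identity = solve-∀

  formMat-·-adj : ∀ x w y z → formMat x w · adj (formMat y z) ≡
    formMat (x * (y + b * K * z) + a * c * (K * K) * w * z) (w * y - x * z)
  formMat-·-adj x w y z =
    mat-cong (entry-α a b c K x w y z) (entry-β a b c K x w y z)
             (entry-γ a b c K x w y z) (entry-δ a b c K x w y z)
    where
    entry-α : ∀ a b c K x w y z →
      x * (y + b * K * z) + (- (c * K * w)) * (- (a * K * z)) ≡
      x * (y + b * K * z) + a * c * (K * K) * w * z
    entry-α = solve-∀
    entry-β : ∀ a b c K x w y z →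
      x * (- (- (c * K * z))) + (- (c * K * w)) * y ≡ - (c * K * (w * y - x * z))
    entry-β = solve-∀
    entry-γ : ∀ a b c K x w y z →
      (a * K * w) * (y + b * K * z) + (x + b * K * w) * (- (a * K * z)) ≡ a * K * (w * y - x * z)
    entry-γ = solve-∀
    entry-δ : ∀ a b c K x w y z →
      (a * K * w) * (- (- (c * K * z))) + (x + b * K * w) * y ≡
      x * (y + b * K * z) + a * c * (K * K) * w * z + b * K * (w * y - x * z)
    entry-δ = solve-∀

  2*trace-·-adj : ∀ x w y z →
    + 2 * trace (x * (y + b * K * z) + a * c * (K * K) * w * z) (w * y - x * z) ≡
    trace x w * trace y z - d₁ * w * z
  2*trace-·-adj x w y z = identity a b c K x w y z
    where
    identity : ∀ a b c K x w y z →
      + 2 * (+ 2 * (x * (y + b * K * z) + a * c * (K * K) * w * z) + b * K * (w * y - x * z)) ≡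
      (+ 2 * x + b * K * w) * (+ 2 * y + b * K * z) - (b * b - + 4 * a * c) * (K * K) * w * z
    identity = solve-∀

  2*w-·-adj : ∀ x w y z → + 2 * (w * y - x * z) ≡ w * trace y z - trace x w * z
  2*w-·-adj x w y z = identity b K x w y z
    where
    identity : ∀ b K x w y z →
      + 2 * (w * y - x * z) ≡ w * (+ 2 * y + b * K * z) - (+ 2 * x + b * K * w) * z
    identity = solve-∀

  formMat-1-0 : formMat (+ 1) (+ 0) ≡ I₂
  formMat-1-0 = mat-cong refl (entry-β c K) (entry-γ a K) (entry-δ b K)
    where
    entry-β : ∀ c K → - (c * K * + 0) ≡ + 0
    entry-β = solve-∀
    entry-γ : ∀ a K → a * K * + 0 ≡ + 0
    entry-γ = solve-∀
    entry-δ : ∀ b K → + 1 + b * K * + 0 ≡ + 1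
    entry-δ = solve-∀

  det-formMat-0 : ∀ x → det (formMat x (+ 0)) ≡ x * x
  det-formMat-0 x = identity a b c K x
    where
    identity : ∀ a b c K x → x * (x + b * K * + 0) - (- (c * K * + 0)) * (a * K * + 0) ≡ x * x
    identity = solve-∀

  trace-0 : ∀ x → trace x (+ 0) ≡ + 2 * x
  trace-0 x = identity b K x
    where
    identity : ∀ b K x → + 2 * x + b * K * + 0 ≡ + 2 * x
    identity = solve-∀

  commutant-equations : ∀ x u g → K * u ≢ + 0 → g · formMat x u ≡ formMat x u · g →
    a * β g + c * γ g ≡ + 0 × a * (δ g - α g) ≡ b * γ g
  commutant-equations x u (mat p q r s) Ku≢0 g·F≡F·g =
    cancel (trans (entry-α a b c K x u p q r s) (difference≡0 (cong α g·F≡F·g))) ,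
    ℤ.i-j≡0⇒i≡j _ _ (cancel (trans (entry-γ a b c K x u p q r s) (difference≡0 (cong γ g·F≡F·g))))
    where
    cancel : ∀ {z} → z * (K * u) ≡ + 0 → z ≡ + 0
    cancel {z} = ℤ.*-cancelʳ-≡ z (+ 0) (K * u) {{≢-nonZero Ku≢0}}
    difference≡0 : ∀ {i j} → i ≡ j → i - j ≡ + 0
    difference≡0 {j = j} refl = ℤ.+-inverseʳ j
    entry-α : ∀ a b c K x u p q r s →
      (a * q + c * r) * (K * u) ≡ (p * x + q * (a * K * u)) - (x * p + (- (c * K * u)) * r)
    entry-α = solve-∀
    entry-γ : ∀ a b c K x u p q r s →
      (a * (s - p) - b * r) * (K * u) ≡
      (r * x + s * (a * K * u)) - ((a * K * u) * p + (x + b * K * u) * r)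
    entry-γ = solve-∀

  proportional⇒formMat : ∀ g y w → γ g ≡ y * a → δ g - α g ≡ b * y → β g ≡ - (c * y) →
                         y ≡ w * K → g ≡ formMat (α g) w
  proportional⇒formMat (mat p q r s) y w refl s-p≡by refl refl =
    mat-cong refl (entry-β c K w) (entry-γ a K w)
             (trans (entry-δ p s) (trans (cong (λ t → p + t) s-p≡by) (entry-δ′ b K p w)))
    where
    entry-β : ∀ c K w → - (c * (w * K)) ≡ - (c * K * w)
    entry-β = solve-∀
    entry-γ : ∀ a K w → w * K * a ≡ a * K * w
    entry-γ = solve-∀
    entry-δ : ∀ p s → s ≡ p + (s - p)
    entry-δ = solve-∀
    entry-δ′ : ∀ b K p w → p + b * (w * K) ≡ p + b * K * w
    entry-δ′ = solve-∀

  InΓP-formMat⇒formMat : ∀ {N} x u g → k ℕ.* gcd ∣ a ∣ N ≡ N → N ≢ 0 → a ≢ + 0 →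
    Primitive a b c → K * u ≢ + 0 → InΓP N (formMat x u) g → ∃[ w ] g ≡ formMat (α g) w
  InΓP-formMat⇒formMat {N} x u g k*g≡N N≢0 a≢0 prim Ku≢0 ((_ , N∣γ) , g·F≡F·g) =
    level (uncurry (primitive-proportional a b c (β g) (γ g) (δ g - α g) a≢0 prim)
                   (commutant-equations x u g Ku≢0 g·F≡F·g))
    where
    level : ∃[ y ] γ g ≡ y * a × δ g - α g ≡ b * y × β g ≡ - (c * y) → ∃[ w ] g ≡ formMat (α g) w
    level (y , γ≡ya , δ-α≡by , β≡-cy) =
      quotient K∣y , proportional⇒formMat g y (quotient K∣y) γ≡ya δ-α≡by β≡-cy (_∣_.equality K∣y)
      where
      K∣y : K ∣ y
      K∣y = ∣ᵤ⇒∣ (k*gcd[m,N]≡N⇒∣ {k} {∣ a ∣} {N} {∣ y ∣} k*g≡N N≢0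
              (subst (N ℕ.∣_) (trans (cong ∣_∣ γ≡ya) (ℤ.abs-* y a)) N∣γ))

  IsFormMat⇒≡formMat : ∀ u v M → IsFormMat a b c k u v M → M ≡ formMat (α M) u
  IsFormMat⇒≡formMat u v (mat p q r s) (2p≡v-z , refl , refl , 2s≡v+z) =
    mat-cong refl refl refl (ℤ.*-cancelˡ-≡ (+ 2) s (p + b * K * u) (begin
      + 2 * s                         ≡⟨ 2s≡v+z ⟩
      v + b * K * u                   ≡⟨ shift v (b * K * u) ⟩
      (v - b * K * u) + + 2 * (b * K * u)  ≡⟨ cong (_+ + 2 * (b * K * u)) 2p≡v-z ⟨
      + 2 * p + + 2 * (b * K * u)     ≡⟨ ℤ.*-distribˡ-+ (+ 2) p (b * K * u) ⟨
      + 2 * (p + b * K * u)           ∎))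
    where
    open ≡-Reasoning
    shift : ∀ v z → v + z ≡ (v - z) + + 2 * z
    shift = solve-∀

  half-trace : ∀ v u → PellSolution d₁ v u → ∃[ x ] + 2 * x ≡ v - b * K * u
  half-trace v u (pell eq) =
    quotient 2∣v-z , trans (ℤ.*-comm (+ 2) _) (sym (_∣_.equality 2∣v-z))
    where
    z = b * K * u
    excess = + 2 + z * z - + 2 * (a * c * (K * K) * (u * u)) - z * v
    square : ∀ a b c K u v → (v - b * K * u) * (v - b * K * u) ≡
      (+ 2 + (b * K * u) * (b * K * u) - + 2 * (a * c * (K * K) * (u * u)) - (b * K * u) * v) * + 2
      + (v * v - (b * b - + 4 * a * c) * (K * K) * (u * u) - + 4)
    square = solve-∀
    2∣v-z : + 2 ∣ v - z
    2∣v-z = 2∣i*i⇒2∣i (divides excess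
      (trans (square a b c K u v) (trans (cong (λ e → excess * + 2 + (e - + 4)) eq) (ℤ.+-identityʳ _))))

  formMat-IsFormMat : ∀ x u v → + 2 * x ≡ v - b * K * u → IsFormMat a b c k u v (formMat x u)
  formMat-IsFormMat x u v 2x≡v-z = 2x≡v-z , refl , refl , (begin
    + 2 * (x + b * K * u)             ≡⟨ ℤ.*-distribˡ-+ (+ 2) x (b * K * u) ⟩
    + 2 * x + + 2 * (b * K * u)       ≡⟨ cong (_+ + 2 * (b * K * u)) 2x≡v-z ⟩
    (v - b * K * u) + + 2 * (b * K * u) ≡⟨ unshift v (b * K * u) ⟩
    v + b * K * u                     ∎)
    where
    open ≡-Reasoning
    unshift : ∀ v z → (v - z) + + 2 * z ≡ v + z
    unshift = solve-∀

  trace≡v : ∀ x u v → + 2 * x ≡ v - b * K * u → trace x u ≡ v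
  trace≡v x u v 2x≡v-z = trans (cong (_+ b * K * u) 2x≡v-z) (cancel v (b * K * u))
    where
    cancel : ∀ v z → v - z + z ≡ v
    cancel = solve-∀

  N∣γ-formMat : ∀ {N} x u → k ℕ.* gcd ∣ a ∣ N ≡ N → + N Unsigned.∣ γ (formMat x u)
  N∣γ-formMat {N} x u k*g≡N =
    subst (N ℕ.∣_) (sym (trans (ℤ.abs-* (a * K) u) (cong (ℕ._* ∣ u ∣) (ℤ.abs-* a K))))
          (ℕ.∣m⇒∣m*n ∣ u ∣ (k*gcd[m,N]≡N⇒N∣m*k {k} {∣ a ∣} {N} k*g≡N))

  module Fundamental (x₁ u₁ : ℤ) (0≤d₁ : + 0 ≤ d₁) (fundamental : IsFundamental d₁ (trace x₁ u₁) u₁)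
    where

    P₁ : Mat
    P₁ = formMat x₁ u₁

    private
      0<t₁ : + 0 < trace x₁ u₁
      0<t₁ = proj₁ fundamental
      0<u₁ : + 0 < u₁
      0<u₁ = proj₁ (proj₂ fundamental)
      pell₁ : PellSolution d₁ (trace x₁ u₁) u₁
      pell₁ = pell (proj₁ (proj₂ (proj₂ fundamental)))
      minimal : ∀ {v u} → + 0 < v → + 0 < u → PellSolution d₁ v u → u₁ ≤ u
      minimal 0<v 0<u (pell eq) = proj₂ (proj₂ (proj₂ fundamental)) _ _ 0<v 0<u eq

    det-P₁ : det P₁ ≡ + 1
    det-P₁ = pell⇒det≡1 x₁ u₁ pell₁

    nonneg-powers : ∀ x w → Acc ℕ._<_ ∣ w ∣ → + 0 ≤ w → det (formMat x w) ≡ + 1 →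
                    + 0 < trace x w → ∃[ m ] formMat x w ≡ powℕ P₁ m
    nonneg-powers x (+ 0) _ _ det≡1 0<trace = 0 , (begin
      formMat x (+ 0)      ≡⟨ cong (λ y → formMat y (+ 0)) x≡1 ⟩
      formMat (+ 1) (+ 0)  ≡⟨ formMat-1-0 ⟩
      I₂                   ∎)
      where
      open ≡-Reasoning
      x≡1 : x ≡ + 1
      x≡1 = square≡1⇒≡1 (0<2*i⇒0<i (subst (+ 0 <_) (trace-0 x) 0<trace))
                        (trans (sym (det-formMat-0 x)) det≡1)
    nonneg-powers x w@(+[1+ _ ]) (acc smaller) _ det≡1 0<trace = ℕ.suc m , (begin
      formMat x w                  ≡⟨ sym (commute⇒B·[A·adjB]≡A (formMat x w) P₁ (formMat-comm x₁ u₁ x w) det-P₁) ⟩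
      P₁ · (formMat x w · adj P₁)  ≡⟨ cong (P₁ ·_) (formMat-·-adj x w x₁ u₁) ⟩
      P₁ · formMat x′ w′           ≡⟨ cong (P₁ ·_) x′w′≡P₁^m ⟩
      P₁ · powℕ P₁ m               ∎)
      where
      open ≡-Reasoning
      x′ w′ : ℤ
      x′ = x * (x₁ + b * K * u₁) + a * c * (K * K) * w * u₁
      w′ = w * x₁ - x * u₁
      pellₓ : PellSolution d₁ (trace x w) w
      pellₓ = det≡1⇒pell x w det≡1
      descent : + 0 < trace x′ w′ × + 0 ≤ w′ × w′ < w
      descent = pell-descent (trace x′ w′) w′ 0≤d₁ 0<trace 0<t₁ 0<u₁
        (minimal 0<trace (+<+ (ℕ.s≤s ℕ.z≤n)) pellₓ) pellₓ pell₁
        (2*trace-·-adj x w x₁ u₁) (2*w-·-adj x w x₁ u₁)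
      det′ : det (formMat x′ w′) ≡ + 1
      det′ = begin
        det (formMat x′ w′)               ≡⟨ cong det (sym (formMat-·-adj x w x₁ u₁)) ⟩
        det (formMat x w · adj P₁)        ≡⟨ det-· (formMat x w) (adj P₁) ⟩
        det (formMat x w) * det (adj P₁)  ≡⟨ cong₂ _*_ det≡1 (trans (det-adj P₁) det-P₁) ⟩
        + 1                               ∎
      0≤w′ = proj₁ (proj₂ descent)
      recursion = nonneg-powers x′ w′ (smaller (∣∣-mono-< 0≤w′ (proj₂ (proj₂ descent))))
                                0≤w′ det′ (proj₁ descent)
      m = proj₁ recursion
      x′w′≡P₁^m = proj₂ recursion

    positive-trace-powers : ∀ x w → det (formMat x w) ≡ + 1 → + 0 < trace x w →
                            ∃[ j ] formMat x w ≡ powℤ P₁ j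
    positive-trace-powers x w det≡1 0<trace with + 0 ℤ.≤? w
    ... | yes 0≤w = let (m , eq) = nonneg-powers x w (<-wellFounded ∣ w ∣) 0≤w det≡1 0<trace
                    in + m , eq
    ... | no  0≰w = - + m , (begin
      formMat x w              ≡⟨ sym (adj-involutive (formMat x w)) ⟩
      adj (adj (formMat x w))  ≡⟨ cong adj (adj-formMat x w) ⟩
      adj (formMat x′ (- w))   ≡⟨ cong adj x′-w≡P₁^m ⟩
      adj (powℕ P₁ m)          ≡⟨ adj-powℕ≡powℤ-neg P₁ m ⟩
      powℤ P₁ (- + m)          ∎)
      where
      open ≡-Reasoning
      x′ = x + b * K * w
      det′ : det (formMat x′ (- w)) ≡ + 1
      det′ = trans (cong det (sym (adj-formMat x w))) (trans (det-adj (formMat x w)) det≡1)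
      recursion = nonneg-powers x′ (- w) (<-wellFounded _) (ℤ.<⇒≤ (ℤ.neg-mono-< (ℤ.≰⇒> 0≰w)))
                                det′ (subst (+ 0 <_) (sym (trace-adj x w)) 0<trace)
      m = proj₁ recursion
      x′-w≡P₁^m = proj₂ recursion

    ±powers : ∀ x w → det (formMat x w) ≡ + 1 → ±PowerOf P₁ (formMat x w)
    ±powers x w det≡1 with ℤ.<-cmp (+ 0) (trace x w)
    ... | tri< 0<trace _ _ = let (j , eq) = positive-trace-powers x w det≡1 0<trace in j , inj₁ eq
    ... | tri≈ _ 0≡trace _ = ⊥-elim (pell-v≢0 0≤d₁ (det≡1⇒pell x w det≡1) (sym 0≡trace))
    ... | tri> _ _ trace<0 = j , inj₂ (begin
      formMat x w                 ≡⟨ sym (negM-involutive (formMat x w)) ⟩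
      negM (negM (formMat x w))   ≡⟨ cong negM (negM-formMat x w) ⟩
      negM (formMat (- x) (- w))  ≡⟨ cong negM -x-w≡P₁^j ⟩
      negM (powℤ P₁ j)            ∎)
      where
      open ≡-Reasoning
      det′ : det (formMat (- x) (- w)) ≡ + 1
      det′ = trans (cong det (sym (negM-formMat x w))) (trans (det-negM (formMat x w)) det≡1)
      negated = positive-trace-powers (- x) (- w) det′
                  (subst (+ 0 <_) (sym (trace-neg x w)) (ℤ.neg-mono-< trace<0))
      j = proj₁ negated
      -x-w≡P₁^j = proj₂ negated

indefinite⇒a≢0 : ∀ a b c → Indefinite a b c → a ≢ + 0
indefinite⇒a≢0 a b c (_ , nonsquare) refl = nonsquare (b , square-disc b c)
  where
  square-disc : ∀ b c → b * b ≡ b * b - + 4 * + 0 * c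
  square-disc = solve-∀

indefinite⇒0≤disc*K² : ∀ a b c K → Indefinite a b c → + 0 ≤ disc a b c * (K * K)
indefinite⇒0≤disc*K² a b c K (0<disc , _) = 0≤i*j (ℤ.<⇒≤ 0<disc) (0≤i*i K)

hyperbolic⇒u≢0 : ∀ d n u v → v * v - d * (u * u) ≡ + 4 * + n → + 4 * + n < v * v → u ≢ + 0
hyperbolic⇒u≢0 d n u v pellᵥ 4n<v² refl =
  ℤ.<-irrefl (trans (sym pellᵥ) (no-u d v)) 4n<v²
  where
  no-u : ∀ d v → v * v - d * (+ 0 * + 0) ≡ v * v
  no-u = solve-∀

lemma4p3 : (N n : ℕ) → 1 ℕ.< N → ¬ SquareFree N → 0 ℕ.< n → Coprime n N →
    (a b c : ℤ) → Primitive a b c → Indefinite a b c →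
    (k : ℕ) → k ℕ.* gcd ∣ a ∣ N ≡ N →
    (u v : ℤ) → v * v - disc a b c * (+ k * + k) * (u * u) ≡ + 4 * + n →
    (M : Mat) → IsFormMat a b c k u v M → InΓ*scaled N n M →
    + 4 * + n < v * v →
    (∃ λ g → InΓP N M g × g ≢ I₂) →
    (v₁ u₁ : ℤ) → IsFundamental (disc a b c * (+ k * + k)) v₁ u₁ →
    Σ Mat λ P₁ → IsFormMat a b c k u₁ v₁ P₁ × InΓ₀ N P₁ × InΓP N M P₁ ×
      (∀ g → InΓP N M g → ∃ λ (j : ℤ) → g ≡ powℤ P₁ j ⊎ g ≡ negM (powℤ P₁ j))
lemma4p3 N n 1<N _ _ _ a b c prim indefinite k k*g≡N u v pellᵥ M M-form _ 4n<v² _ v₁ u₁ fundamental =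
  P₁ , formMat-IsFormMat x₁ u₁ v₁ 2x₁≡v₁-z , P₁∈Γ₀ , (P₁∈Γ₀ , P₁·M≡M·P₁) , Γ_P-generated
  where
  open FormMatrix a b c k
  N≢0 : N ≢ 0
  N≢0 = ℕ.m<n⇒n≢0 1<N
  halving : ∃[ x ] + 2 * x ≡ v₁ - b * K * u₁
  halving = half-trace v₁ u₁ (pell (proj₁ (proj₂ (proj₂ fundamental))))
  x₁ : ℤ
  x₁ = proj₁ halving
  2x₁≡v₁-z : + 2 * x₁ ≡ v₁ - b * K * u₁
  2x₁≡v₁-z = proj₂ halving
  open Fundamental x₁ u₁ (indefinite⇒0≤disc*K² a b c K indefinite)
                   (subst (λ t → IsFundamental d₁ t u₁) (sym (trace≡v x₁ u₁ v₁ 2x₁≡v₁-z)) fundamental)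
  M≡formMat : M ≡ formMat (α M) u
  M≡formMat = IsFormMat⇒≡formMat u v M M-form
  P₁∈Γ₀ : InΓ₀ N P₁
  P₁∈Γ₀ = det-P₁ , N∣γ-formMat x₁ u₁ k*g≡N
  P₁·M≡M·P₁ : P₁ · M ≡ M · P₁
  P₁·M≡M·P₁ = subst (λ X → P₁ · X ≡ X · P₁) (sym M≡formMat) (formMat-comm x₁ u₁ (α M) u)
  Γ_P-generated : ∀ g → InΓP N M g → ±PowerOf P₁ g
  Γ_P-generated g g∈Γ_P =
    let (w , g≡formMat) = InΓP-formMat⇒formMat (α M) u g k*g≡N N≢0 (indefinite⇒a≢0 a b c indefinite)
                            prim (k*gcd[m,N]≡N⇒k*u≢0 {k} {∣ a ∣} {N} {u} k*g≡N N≢0 (hyperbolic⇒u≢0 d₁ n u v pellᵥ 4n<v²))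
                            (subst (λ X → InΓP N X g) M≡formMat g∈Γ_P)
    in subst (±PowerOf P₁) (sym g≡formMat)
             (±powers (α g) w (trans (cong det (sym g≡formMat)) (proj₁ (proj₁ g∈Γ_P))))
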